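{- For every integer $m\ge1$, $Y\cdot P^m\cdot Y=P^m$ in $B^{\otimes(m+1)}$, where $P=X\otimes Y+Y\otimes X$.
   Context: Let $\mathcal M=\mathbb Z\langle y,n\rangle/(yn=ny=n,\ n^2=0,\ y^2=y)$. In the ring $\mathcal M\otimes\mathcal M$ (tensor over $\mathbb Z$, with $(a\otimes b)(c\otimes d)=ac\otimes bd$) put $X=y\otimes n+n\otimes y$, $Y=y\otimes y$, $Z=n\otimes n$, and let $B$ be the $\mathbb Z$-span of $X,Y,Z$: a commutative subring with $X^2=2Z$, $Y^2=Y$, $Z^2=0$, $XY=YX=X$, $XZ=ZX=0$, $YZ=ZY=Z$. The chaining product $B^{\otimes r}\times B^{\otimes s}\to B^{\otimes(r+s-1)}$ (tensor powers over $\mathbb Z$) is the bilinear (associative) map $(a_1\otimes\cdots\otimes a_r)\cdot(b_1\otimes\cdots\otimes b_s)=a_1\otimes\cdots\otimes a_{r-1}\otimes(a_rb_1)\otimes b_2\otimes\cdots\otimes b_s$. Elements of $B$ are regarded as elements of $B^{\otimes1}$. $P^m\in B^{\otimes(m+1)}$ denotes the $m$-fold chaining product of $P$. -}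

module Defs where

open import Data.Nat using (ℕ; zero; suc)
open import Data.Integer using (ℤ; +_; _*_; _+_)
open import Data.Nat using () renaming (_+_ to _+ℕ_)
open import Data.List using (List; foldr; map; concatMap) renaming (_∷_ to _∷ₗ_; [] to []ₗ)
open import Data.Vec using (Vec; []; _∷_; _∷ʳ_)
open import Data.Product using (_×_; _,_)

-- The Z-basis {X, Y, Z} of B (B is a free Z-module of rank 3, since
-- M is free on 1, y, n and X, Y, Z are independent in M ⊗ M).
data Basis : Set where
  X Y Z : Basis

allBasis : List Basis
allBasis = X ∷ₗ Y ∷ₗ Z ∷ₗ []ₗ

-- mulCoeff a b c = coefficient of basis element c in the product a·b in B,
-- from X²=2Z, Y²=Y, Z²=0, XY=YX=X, XZ=ZX=0, YZ=ZY=Z.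
mulCoeff : Basis → Basis → Basis → ℤ
mulCoeff X X Z = + 2
mulCoeff Y Y Y = + 1
mulCoeff X Y X = + 1
mulCoeff Y X X = + 1
mulCoeff Y Z Z = + 1
mulCoeff Z Y Z = + 1
mulCoeff _ _ _ = + 0

-- An element of B^{⊗n}: its coordinates in the basis of pure tensors
-- of basis elements (words of length n over {X,Y,Z}).
T : ℕ → Set
T n = Vec Basis n → ℤ

sumℤ : List ℤ → ℤ
sumℤ = foldr _+_ (+ 0)

split : ∀ r {s} → Vec Basis (suc (r +ℕ s)) → Vec Basis r × Basis × Vec Basis s
split zero (c ∷ v) = [] , c , v
split (suc r) (a ∷ w) with split r w
... | u , c , v = a ∷ u , c , v

-- Chaining product B^{⊗(r+1)} × B^{⊗(s+1)} → B^{⊗(r+s+1)}, the bilinear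
-- extension of (a₁⊗…⊗a_{r+1})·(b₁⊗…⊗b_{s+1}) = a₁⊗…⊗(a_{r+1}b₁)⊗…⊗b_{s+1},
-- written coordinatewise.
chain : ∀ {r s} → T (suc r) → T (suc s) → T (suc (r +ℕ s))
chain {r} {s} f g w with split r {s} w
... | u , c , v =
  sumℤ (concatMap (λ a → map (λ b → f (u ∷ʳ a) * g (b ∷ v) * mulCoeff a b c) allBasis) allBasis)

Yt : T 1
Yt (Y ∷ []) = + 1
Yt _ = + 0

P : T 2
P (X ∷ Y ∷ []) = + 1
P (Y ∷ X ∷ []) = + 1
P _ = + 0

-- Ppow k = P^{k+1} ∈ B^{⊗(k+2)}, the (k+1)-fold chaining product of P
Ppow : (k : ℕ) → T (suc (suc k))
Ppow zero = P
Ppow (suc k) = chain {1} {suc k} P (Ppow k)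

{-# OPTIONS --safe #-}
-- Y = y ⊗ y is the identity element of B, so multiplying by Y on the far
-- left or far right of a chain multiplies a single tensor factor by 1 and
-- changes nothing; the identity Y · Q · Y = Q therefore holds for every
-- Q ∈ B^{⊗(m+1)}, in particular for Q = P^m.
module Submission where

open import Defs
open import Data.Nat using (ℕ; suc; pred; _+_)
open import Data.Nat.Properties using (+-identityʳ)
open import Data.Integer using (ℤ; +_; _*_) renaming (_+_ to _+ℤ_)
import Data.Integer.Properties as ℤ
open import Algebra.Properties.CommutativeSemigroup ℤ.*-commutativeSemigroup using (xy∙z≈y∙xz)
open import Data.List using (List; map; concatMap; _++_) renaming (_∷_ to _∷ₗ_; [] to []ₗ)
open import Data.List.Properties using (map-cong)
open import Data.Vec using (Vec; cast; []; _∷_; _∷ʳ_; initLast)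
open import Data.Product using (_,_)
open import Relation.Binary.PropositionalEquality
  using (_≡_; refl; sym; trans; cong; module ≡-Reasoning)
open ≡-Reasoning

sumℤ-++ : ∀ (xs ys : List ℤ) → sumℤ (xs ++ ys) ≡ sumℤ xs +ℤ sumℤ ys
sumℤ-++ []ₗ       ys = sym (ℤ.+-identityˡ (sumℤ ys))
sumℤ-++ (x ∷ₗ xs) ys = trans (cong (x +ℤ_) (sumℤ-++ xs ys)) (sym (ℤ.+-assoc x (sumℤ xs) (sumℤ ys)))

sumℤ-concatMap : ∀ {A : Set} (f : A → List ℤ) (xs : List A) →
  sumℤ (concatMap f xs) ≡ sumℤ (map (λ x → sumℤ (f x)) xs)
sumℤ-concatMap f []ₗ       = refl
sumℤ-concatMap f (x ∷ₗ xs) =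
  trans (sumℤ-++ (f x) (concatMap f xs)) (cong (sumℤ (f x) +ℤ_) (sumℤ-concatMap f xs))

sumℤ-*-distribˡ : ∀ k (xs : List ℤ) → k * sumℤ xs ≡ sumℤ (map (k *_) xs)
sumℤ-*-distribˡ k []ₗ       = ℤ.*-zeroʳ k
sumℤ-*-distribˡ k (x ∷ₗ xs) = trans (ℤ.*-distribˡ-+ k x (sumℤ xs)) (cong (k * x +ℤ_) (sumℤ-*-distribˡ k xs))

ΣB : (Basis → ℤ) → ℤ
ΣB t = sumℤ (map t allBasis)

ΣB-cong : ∀ {s t : Basis → ℤ} → (∀ a → s a ≡ t a) → ΣB s ≡ ΣB t
ΣB-cong s≗t = cong sumℤ (map-cong s≗t allBasis)

ΣB-*-distribˡ : ∀ k (t : Basis → ℤ) → k * ΣB t ≡ ΣB (λ a → k * t a)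
ΣB-*-distribˡ k t = sumℤ-*-distribˡ k (map t allBasis)

δ : Basis → Basis → ℤ
δ X X = + 1
δ Y Y = + 1
δ Z Z = + 1
δ _ _ = + 0

ΣB-δ : ∀ c (t : Basis → ℤ) → ΣB (λ a → δ c a * t a) ≡ t c
ΣB-δ X t = trans (ℤ.+-identityʳ (+ 1 * t X)) (ℤ.*-identityˡ (t X))
ΣB-δ Y t = trans (ℤ.+-identityˡ _) (trans (ℤ.+-identityʳ (+ 1 * t Y)) (ℤ.*-identityˡ (t Y)))
ΣB-δ Z t =
  trans (ℤ.+-identityˡ _) (trans (ℤ.+-identityˡ _) (trans (ℤ.+-identityʳ (+ 1 * t Z)) (ℤ.*-identityˡ (t Z))))

mulCoeff-Yˡ : ∀ b c → mulCoeff Y b c ≡ δ c b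
mulCoeff-Yˡ X X = refl
mulCoeff-Yˡ X Y = refl
mulCoeff-Yˡ X Z = refl
mulCoeff-Yˡ Y X = refl
mulCoeff-Yˡ Y Y = refl
mulCoeff-Yˡ Y Z = refl
mulCoeff-Yˡ Z X = refl
mulCoeff-Yˡ Z Y = refl
mulCoeff-Yˡ Z Z = refl

mulCoeff-Yʳ : ∀ a c → mulCoeff a Y c ≡ δ c a
mulCoeff-Yʳ X X = refl
mulCoeff-Yʳ X Y = refl
mulCoeff-Yʳ X Z = refl
mulCoeff-Yʳ Y X = refl
mulCoeff-Yʳ Y Y = refl
mulCoeff-Yʳ Y Z = refl
mulCoeff-Yʳ Z X = refl
mulCoeff-Yʳ Z Y = refl
mulCoeff-Yʳ Z Z = refl

-- The product of B in coordinates: it is the sum chain uses on the middle factor.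
-- δ c is the coordinate vector of the basis element c, so δ Y agrees with Yt.
_·_ : (Basis → ℤ) → (Basis → ℤ) → Basis → ℤ
(f · g) c = sumℤ (concatMap (λ a → map (λ b → f a * g b * mulCoeff a b c) allBasis) allBasis)

·-double-sum : ∀ f g c → (f · g) c ≡ ΣB (λ a → ΣB (λ b → f a * g b * mulCoeff a b c))
·-double-sum f g c = sumℤ-concatMap (λ a → map (λ b → f a * g b * mulCoeff a b c) allBasis) allBasis

·-identityˡ : ∀ g c → (δ Y · g) c ≡ g c
·-identityˡ g c = begin
  (δ Y · g) c                                             ≡⟨ ·-double-sum (δ Y) g c ⟩
  ΣB (λ a → ΣB (λ b → δ Y a * g b * mulCoeff a b c))      ≡⟨ ΣB-cong factor-out ⟩
  ΣB (λ a → δ Y a * ΣB (λ b → g b * mulCoeff a b c))      ≡⟨ ΣB-δ Y (λ a → ΣB (λ b → g b * mulCoeff a b c)) ⟩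
  ΣB (λ b → g b * mulCoeff Y b c)                         ≡⟨ ΣB-cong unit ⟩
  ΣB (λ b → δ c b * g b)                                  ≡⟨ ΣB-δ c g ⟩
  g c                                                     ∎
  where
  factor-out : ∀ a → ΣB (λ b → δ Y a * g b * mulCoeff a b c) ≡ δ Y a * ΣB (λ b → g b * mulCoeff a b c)
  factor-out a = begin
    ΣB (λ b → δ Y a * g b * mulCoeff a b c)    ≡⟨ ΣB-cong (λ b → ℤ.*-assoc (δ Y a) (g b) (mulCoeff a b c)) ⟩
    ΣB (λ b → δ Y a * (g b * mulCoeff a b c))  ≡⟨ ΣB-*-distribˡ (δ Y a) (λ b → g b * mulCoeff a b c) ⟨
    δ Y a * ΣB (λ b → g b * mulCoeff a b c)    ∎
  unit : ∀ b → g b * mulCoeff Y b c ≡ δ c b * g b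
  unit b = trans (cong (g b *_) (mulCoeff-Yˡ b c)) (ℤ.*-comm (g b) (δ c b))

·-identityʳ : ∀ f c → (f · δ Y) c ≡ f c
·-identityʳ f c = begin
  (f · δ Y) c                                             ≡⟨ ·-double-sum f (δ Y) c ⟩
  ΣB (λ a → ΣB (λ b → f a * δ Y b * mulCoeff a b c))      ≡⟨ ΣB-cong commute-δ ⟩
  ΣB (λ a → ΣB (λ b → δ Y b * (f a * mulCoeff a b c)))    ≡⟨ ΣB-cong (λ a → ΣB-δ Y (λ b → f a * mulCoeff a b c)) ⟩
  ΣB (λ a → f a * mulCoeff a Y c)                         ≡⟨ ΣB-cong unit ⟩
  ΣB (λ a → δ c a * f a)                                  ≡⟨ ΣB-δ c f ⟩
  f c                                                     ∎
  where
  commute-δ : ∀ a → ΣB (λ b → f a * δ Y b * mulCoeff a b c) ≡ ΣB (λ b → δ Y b * (f a * mulCoeff a b c))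
  commute-δ a = ΣB-cong (λ b → xy∙z≈y∙xz (f a) (δ Y b) (mulCoeff a b c))
  unit : ∀ a → f a * mulCoeff a Y c ≡ δ c a * f a
  unit a = trans (cong (f a *_) (mulCoeff-Yʳ a c)) (ℤ.*-comm (f a) (δ c a))

chain-Ytˡ : ∀ {s} (g : T (suc s)) (w : Vec Basis (suc s)) → chain {0} {s} Yt g w ≡ g w
chain-Ytˡ g (c ∷ v) = ·-identityˡ (λ b → g (b ∷ v)) c

split-cast-∷ʳ : ∀ {r} (u : Vec Basis r) c .(eq : suc r ≡ suc (r + 0)) →
  split r {0} (cast eq (u ∷ʳ c)) ≡ (u , c , [])
split-cast-∷ʳ []      c eq = refl
split-cast-∷ʳ (a ∷ u) c eq rewrite split-cast-∷ʳ u c (cong pred eq) = refl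

chain-Ytʳ : ∀ {r} (f : T (suc r)) (w : Vec Basis (suc r)) .(eq : suc r ≡ suc (r + 0)) →
  chain {r} {0} f Yt (cast eq w) ≡ f w
chain-Ytʳ f w eq with initLast w
... | u , c , refl rewrite split-cast-∷ʳ u c eq = ·-identityʳ (λ a → f (u ∷ʳ a)) c

lemma5p5 : (k : ℕ) → (w : Vec Basis (suc (suc k))) →
    chain {suc k} {0} (chain {0} {suc k} Yt (Ppow k)) Yt (cast (cong suc (sym (+-identityʳ (suc k)))) w) ≡ Ppow k w
lemma5p5 k w = begin
  chain (chain Yt (Ppow k)) Yt (cast _ w)  ≡⟨ chain-Ytʳ (chain Yt (Ppow k)) w _ ⟩
  chain Yt (Ppow k) w                      ≡⟨ chain-Ytˡ (Ppow k) w ⟩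
  Ppow k w                                 ∎
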